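{- Let $s \geq 4$ be an integer and let $r \in \left\{s+1, s+2, \dots, s + \left\lceil \frac{s-3}{2} \right\rceil\right\}$. Then there exist an integer $n \geq 2r+1$ and a graph $\mathcal{G}$ with vertex set $[n]$ such that $\chi\left(\mathrm{KG}^r(\mathcal{G}_{s\text{ -stable}})\right) = 0$ and $\left\lceil \frac{\mathrm{cd}^r(\mathcal{G})}{r-1} \right\rceil = 1$.
   Context: $[n]=\{1,\dots,n\}$. A hypergraph $\mathcal{H}$ on vertex set $V$ is a family $E(\mathcal{H})$ of nonempty subsets of $V$ (hyperedges); a graph is a hypergraph all of whose hyperedges have size 2. A set $S \subseteq [n]$ is $s$-stable if any two distinct $i,j \in S$ satisfy $s \leq |i-j| \leq n-s$. For a hypergraph $\mathcal{H}$ on $[n]$, $\mathcal{H}_{s\text{ -stable}}$ denotes the hypergraph on $[n]$ whose hyperedges are the $s$-stable hyperedges of $\mathcal{H}$. For a hypergraph $\mathcal{F}$ and $r\ge 2$, the general Kneser hypergraph $\mathrm{KG}^r(\mathcal{F})$ has vertex set $E(\mathcal{F})$, and its hyperedges are the sets of $r$ pairwise disjoint hyperedges of $\mathcal{F}$. The chromatic number $\chi$ of a hypergraph is the least number of colors in a vertex coloring with no monochromatic hyperedge (it is $0$ when the vertex set is empty). The $r$-colorability defect $\mathrm{cd}^r(\mathcal{H})$ is the minimum size of a set $S \subseteq V(\mathcal{H})$ such that the induced subhypergraph on $V(\mathcal{H})\setminus S$ (whose hyperedges are the hyperedges of $\mathcal{H}$ contained in $V(\mathcal{H})\setminus S$)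 admits a vertex coloring with at most $r$ colors having no monochromatic hyperedge. -}

module Defs where

open import Data.Nat using (ℕ; zero; suc; _+_; _∸_; _≤_; _<_; ∣_-_∣)
open import Data.Nat.DivMod using (_/_)
open import Data.Fin using (Fin; toℕ)
open import Data.Fin.Subset using (Subset; _∈_; _⊆_; ∁; ∣_∣; Nonempty)
open import Data.Product using (Σ; ∃; _×_)
open import Relation.Binary.PropositionalEquality using (_≡_; _≢_)
open import Relation.Nullary using (¬_)
open import Data.Empty using (⊥)

-- Ceiling division ⌈ a / m ⌉ (junk value 0 when m = 0).
⌈_/_⌉ : ℕ → ℕ → ℕ
⌈ a / zero ⌉ = 0
⌈ a / suc k ⌉ = (a + k) / suc k

-- A hypergraph on [n] (vertices represented by Fin n, i.e. 0..n-1; only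
-- differences |i-j| matter, so this shift is harmless).
record Hypergraph (n : ℕ) : Set₁ where
  field
    Edge     : Subset n → Set
    nonempty : ∀ {e} → Edge e → Nonempty e
open Hypergraph public

IsGraph : ∀ {n} → Hypergraph n → Set
IsGraph {n} H = ∀ e → Edge H e → ∣ e ∣ ≡ 2

Stable : ∀ {n} → ℕ → Subset n → Set
Stable {n} s S = ∀ i j → i ∈ S → j ∈ S → i ≢ j →
  (s ≤ ∣ toℕ i - toℕ j ∣) × (∣ toℕ i - toℕ j ∣ ≤ n ∸ s)

stablePart : ∀ {n} → ℕ → Hypergraph n → Hypergraph n
stablePart s H = record
  { Edge = λ e → Edge H e × Stable s e
  ; nonempty = λ p → nonempty H (Data.Product.proj₁ p) }

Disjoint : ∀ {n} → Subset n → Subset n → Set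
Disjoint a b = ∀ i → i ∈ a → i ∈ b → ⊥

record GHypergraph : Set₁ where
  field
    Vtx   : Set
    HEdge : Set
    _∈ₕ_  : Vtx → HEdge → Set
open GHypergraph public

Monochromatic : (H : GHypergraph) {k : ℕ} → (Vtx H → Fin k) → HEdge H → Set
Monochromatic H {k} c h = ∃ λ (col : Fin k) → ∀ v → _∈ₕ_ H v h → c v ≡ col

Colorable : GHypergraph → ℕ → Set
Colorable H k = Σ (Vtx H → Fin k) λ c → ∀ h → ¬ Monochromatic H c h

-- χ(H) = k : least number of colors of a proper coloring
-- (k = 0 exactly when the vertex set is empty).
IsChromaticNumber : GHypergraph → ℕ → Set
IsChromaticNumber H k = Colorable H k × (∀ j → j < k → ¬ Colorable H j)

record KGVertex {n} (F : Hypergraph n) : Set where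
  constructor kgv
  field
    set     : Subset n
    .isEdge : Edge F set
open KGVertex public

-- General Kneser hypergraph KG^r(F): hyperedges are the sets of r pairwise
-- disjoint hyperedges of F, given as families indexed by Fin r
-- (pairwise disjointness of nonempty sets forces them to be distinct).
KG : ℕ → ∀ {n} → Hypergraph n → GHypergraph
KG r F = record
  { Vtx   = KGVertex F
  ; HEdge = Σ (Fin r → KGVertex F) λ f →
              ∀ a b → a ≢ b → Disjoint (set (f a)) (set (f b))
  ; _∈ₕ_  = λ v h → ∃ λ a → Data.Product.proj₁ h a ≡ v }

-- After deleting S, the induced subhypergraph has a proper r-coloring
-- (colors assigned to S are irrelevant).
ColorableAfterRemoving : ∀ {n} → Hypergraph n → ℕ → Subset n → Set
ColorableAfterRemoving {n} H r S =
  Σ (Fin n → Fin r) λ c → ∀ e → Edge H e → e ⊆ ∁ S →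
    ¬ (∃ λ (col : Fin r) → ∀ i → i ∈ e → c i ≡ col)

IsColorabilityDefect : ∀ {n} → Hypergraph n → ℕ → ℕ → Set
IsColorabilityDefect {n} H r d =
  (∃ λ (S : Subset n) → ∣ S ∣ ≡ d × ColorableAfterRemoving H r S)
  × (∀ S → ColorableAfterRemoving H r S → d ≤ ∣ S ∣)

-- The graph G joins two vertices of [2r+1] exactly when they are not at
-- s-stable distance, so G_{s-stable} has no edges and χ(KG^r(G_{s-stable})) = 0.
-- Deleting the last vertex, colouring i by i mod r is proper: two vertices of
-- [2r] with the same residue are at distance exactly r, which is s-stable
-- because s < r. Without deleting a vertex no proper r-colouring exists: some
-- colour class would contain three pairwise s-stable points of the cycle of
-- length 2r+1, forcing 3s ≤ 2r+1, which the upper bound on r rules out.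
module Submission where

open import Defs
open import Data.Nat using (ℕ; suc; _+_; _*_; _∸_; _≤_)
open import Data.Product using (Σ; ∃; _×_)
open import Relation.Binary.PropositionalEquality using (_≡_)

open import Data.Nat using (zero; _<_; z≤n; s≤s; s≤s⁻¹; z<s; ∣_-_∣; NonZero; >-nonZero)
open import Data.Nat.Properties
open import Data.Nat.DivMod using (_%_; _/_; m%n<n; m≡m%n+[m/n]*n; m<n*o⇒m/o<n; m/n*n≤m; n/n≡1)
open import Data.Nat.Tactic.RingSolver using (solve-∀)
open import Data.Fin as Fin using (Fin; toℕ; fromℕ; fromℕ<; combine)
open import Data.Fin.Properties
  using (toℕ-injective; toℕ-fromℕ; toℕ-fromℕ<; toℕ<n; pigeonhole; combine-injective; any?)
  renaming (<⇒≢ to <⇒≢ᶠ; _<?_ to _<ᶠ?_; _≟_ to _≟ᶠ_)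
open import Data.Fin.Subset using (Subset; ⁅_⁆; _∪_; _∈_; _⊆_; ∁; ∣_∣; Nonempty)
open import Data.Fin.Subset.Properties
  using (x∈⁅x⁆; x∈⁅y⁆⇒x≡y; ∣⁅x⁆∣≡1; x∉⁅y⁆⇒x≢y; x∉p⇒x∈∁p; x∈∁p⇒x∉p; x∈p∪q⁺; x∈p∪q⁻;
         ∪-identityˡ; ∪-identityʳ; nonempty?; x∈p⇒∣p-x∣<∣p∣)
open import Data.Product using (_,_; ∃₂)
open import Data.Sum using (_⊎_; inj₁; inj₂)
open import Data.Empty using (⊥-elim; ⊥-elim-irr)
open import Function using (_∘_)
open import Relation.Nullary using (Dec; yes; no; ¬_)
open import Relation.Nullary.Decidable using (_×-dec_)
open import Relation.Binary.PropositionalEquality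
  using (_≢_; refl; sym; trans; cong; cong₂; subst; module ≡-Reasoning)

pair : ∀ {n} → Fin n → Fin n → Subset n
pair i j = ⁅ i ⁆ ∪ ⁅ j ⁆

∈-pairˡ : ∀ {n} {i j : Fin n} → i ∈ pair i j
∈-pairˡ {i = i} = x∈p∪q⁺ (inj₁ (x∈⁅x⁆ i))

∈-pairʳ : ∀ {n} {i j : Fin n} → j ∈ pair i j
∈-pairʳ {j = j} = x∈p∪q⁺ (inj₂ (x∈⁅x⁆ j))

∈-pair⁻ : ∀ {n} {i j x : Fin n} → x ∈ pair i j → x ≡ i ⊎ x ≡ j
∈-pair⁻ {i = i} {j} x∈ with x∈p∪q⁻ ⁅ i ⁆ ⁅ j ⁆ x∈
... | inj₁ x∈⁅i⁆ = inj₁ (x∈⁅y⁆⇒x≡y i x∈⁅i⁆)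
... | inj₂ x∈⁅j⁆ = inj₂ (x∈⁅y⁆⇒x≡y j x∈⁅j⁆)

∣pair∣≡2 : ∀ {n} {i j : Fin n} → i ≢ j → ∣ pair i j ∣ ≡ 2
∣pair∣≡2 {i = Fin.zero}  {Fin.zero}  i≢j = ⊥-elim (i≢j refl)
∣pair∣≡2 {i = Fin.zero}  {Fin.suc j} _   rewrite ∪-identityˡ ⁅ j ⁆ = cong suc (∣⁅x⁆∣≡1 j)
∣pair∣≡2 {i = Fin.suc i} {Fin.zero}  _   rewrite ∪-identityʳ ⁅ i ⁆ = cong suc (∣⁅x⁆∣≡1 i)
∣pair∣≡2 {i = Fin.suc i} {Fin.suc j} i≢j = ∣pair∣≡2 (i≢j ∘ cong Fin.suc)

StableDistance : ℕ → ℕ → ℕ → Set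
StableDistance n s d = s ≤ d × d ≤ n ∸ s

stableDistance? : ∀ n s d → Dec (StableDistance n s d)
stableDistance? n s d = (s ≤? d) ×-dec (d ≤? n ∸ s)

UnstablePair : ∀ {n} → ℕ → Fin n → Fin n → Set
UnstablePair {n} s i j = i ≢ j × ¬ StableDistance n s ∣ toℕ i - toℕ j ∣

unstableGraph : ∀ n → ℕ → Hypergraph n
unstableGraph n s = record { Edge = UnstableEdge ; nonempty = nonempty-edge }
  where
  UnstableEdge : Subset n → Set
  UnstableEdge e = ∃₂ λ i j → UnstablePair s i j × e ≡ pair i j

  nonempty-edge : ∀ {e} → UnstableEdge e → Nonempty e
  nonempty-edge (i , j , _ , refl) = i , ∈-pairˡ

unstableGraph-isGraph : ∀ n s → IsGraph (unstableGraph n s)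
unstableGraph-isGraph n s _ (i , j , (i≢j , _) , refl) = ∣pair∣≡2 i≢j

stablePart-unstableGraph-edgeless : ∀ {n} s e → ¬ Edge (stablePart s (unstableGraph n s)) e
stablePart-unstableGraph-edgeless s _ ((i , j , (i≢j , unstable) , refl) , stable) =
  unstable (stable i j ∈-pairˡ ∈-pairʳ i≢j)

chromaticNumber-noVertices : (H : GHypergraph) → ¬ Vtx H → IsChromaticNumber H 0
chromaticNumber-noVertices H noVertex = (⊥-elim ∘ noVertex , λ _ ()) , λ _ ()

KG-edgeless-χ≡0 : ∀ r {n} (F : Hypergraph n) → (∀ e → ¬ Edge F e) →
                  IsChromaticNumber (KG r F) 0
KG-edgeless-χ≡0 r F edgeless = chromaticNumber-noVertices (KG r F) noVertex
  where
  noVertex : ¬ KGVertex F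
  noVertex (kgv e e-edge) = ⊥-elim-irr (edgeless e e-edge)

-- Pigeonhole on the pair (colour of v, whether some u < v has the same
-- colour): two vertices agreeing on both yield three of the same colour.
module _ {m n : ℕ} (f : Fin n → Fin m) where

  private
    Repeats : Fin n → Set
    Repeats v = ∃ λ u → u Fin.< v × f u ≡ f v

    repeats? : ∀ v → Dec (Repeats v)
    repeats? v = any? λ u → (u <ᶠ? v) ×-dec (f u ≟ᶠ f v)

    flag : ∀ {A : Set} → Dec A → Fin 2
    flag (yes _) = Fin.suc Fin.zero
    flag (no _)  = Fin.zero

    third : ∀ {i j} → i Fin.< j → f i ≡ f j →
            (ri : Dec (Repeats i)) (rj : Dec (Repeats j)) → flag ri ≡ flag rj →
            ∃ λ u → u Fin.< i × f u ≡ f i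
    third _ _ (yes repeated) _ _ = repeated
    third _ _ (no _) (yes _) ()
    third {i} i<j fi≡fj (no _) (no ¬rj) _ = ⊥-elim (¬rj (i , i<j , fi≡fj))

  pigeonhole₃ : m * 2 < n →
    ∃ λ u → ∃₂ λ i j → u Fin.< i × i Fin.< j × f u ≡ f i × f i ≡ f j
  pigeonhole₃ m*2<n with pigeonhole m*2<n (λ v → combine (f v) (flag (repeats? v)))
  ... | i , j , i<j , same with combine-injective (f i) _ (f j) _ same
  ... | fi≡fj , flags≡ with third i<j fi≡fj (repeats? i) (repeats? j) flags≡
  ... | u , u<i , fu≡fi = u , i , j , u<i , i<j , fu≡fi , fi≡fj

stableTriple⇒3s≤n : ∀ {n s a b c} → a < b → b < c → c < n →
  StableDistance n s ∣ a - b ∣ → StableDistance n s ∣ b - c ∣ →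
  StableDistance n s ∣ a - c ∣ → 3 * s ≤ n
stableTriple⇒3s≤n {n} {s} {a} a<b b<c c<n (s≤ab , _) (s≤bc , _) (_ , ac≤n∸s)
  with x , refl ← m≤n⇒∃[o]m+o≡n (<⇒≤ a<b)
  with y , refl ← m≤n⇒∃[o]m+o≡n (<⇒≤ b<c) = begin
    3 * s          ≡⟨ threeTimes s ⟩
    s + s + s      ≤⟨ +-monoˡ-≤ s (+-mono-≤ s≤x s≤y) ⟩
    x + y + s      ≤⟨ +-monoˡ-≤ s x+y≤n∸s ⟩
    n ∸ s + s      ≡⟨ m∸n+n≡m s≤n ⟩
    n              ∎
  where
  open ≤-Reasoning
  threeTimes : ∀ s → 3 * s ≡ s + s + s
  threeTimes = solve-∀
  s≤x : s ≤ x
  s≤x = subst (s ≤_) (∣m-m+n∣≡n a x) s≤ab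
  s≤y : s ≤ y
  s≤y = subst (s ≤_) (∣m-m+n∣≡n (a + x) y) s≤bc
  x+y≤n∸s : x + y ≤ n ∸ s
  x+y≤n∸s = subst (_≤ n ∸ s) (trans (cong (∣_-_∣ a) (+-assoc a x y)) (∣m-m+n∣≡n a (x + y)))
                  ac≤n∸s
  s≤n : s ≤ n
  s≤n = ≤-trans s≤x (≤-trans (m≤n+m x a) (≤-trans (m≤m+n (a + x) y) (<⇒≤ c<n)))

monochromaticUnstablePair : ∀ {n r s} → r * 2 < n → n < 3 * s → (c : Fin n → Fin r) →
  ∃₂ λ i j → UnstablePair s i j × c i ≡ c j
monochromaticUnstablePair {n} {r} {s} r*2<n n<3s c
  with u , i , j , u<i , i<j , cu≡ci , ci≡cj ← pigeonhole₃ c r*2<n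
  with stableDistance? n s ∣ toℕ u - toℕ i ∣
     | stableDistance? n s ∣ toℕ i - toℕ j ∣
     | stableDistance? n s ∣ toℕ u - toℕ j ∣
... | no ¬ui | _      | _      = u , i , (<⇒≢ᶠ u<i , ¬ui) , cu≡ci
... | yes _  | no ¬ij | _      = i , j , (<⇒≢ᶠ i<j , ¬ij) , ci≡cj
... | yes _  | yes _  | no ¬uj = u , j , (<⇒≢ᶠ (<-trans u<i i<j) , ¬uj) , trans cu≡ci ci≡cj
... | yes ui | yes ij | yes uj =
  ⊥-elim (<⇒≱ n<3s (stableTriple⇒3s≤n u<i i<j (toℕ<n j) ui ij uj))

unstableGraph-needsRemoval : ∀ {n r s} → r * 2 < n → n < 3 * s →
  ∀ S → ColorableAfterRemoving (unstableGraph n s) r S → 1 ≤ ∣ S ∣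
unstableGraph-needsRemoval r*2<n n<3s S (c , proper) with nonempty? S
... | yes (_ , x∈S) = ≤-trans (s≤s z≤n) (x∈p⇒∣p-x∣<∣p∣ x∈S)
... | no S-empty with monochromaticUnstablePair r*2<n n<3s c
... | i , j , unstable , ci≡cj = ⊥-elim (proper (pair i j) (i , j , unstable , refl)
  (λ {x} _ → x∉p⇒x∈∁p (λ x∈S → S-empty (x , x∈S))) (c i , monochromatic))
  where
  monochromatic : ∀ x → x ∈ pair i j → c x ≡ c i
  monochromatic x x∈ with ∈-pair⁻ x∈
  ... | inj₁ refl = refl
  ... | inj₂ refl = sym ci≡cj

∣p*d-q*d∣≡d : ∀ {p q} d → p < 2 → q < 2 → p ≢ q → ∣ p * d - q * d ∣ ≡ d
∣p*d-q*d∣≡d {0} {0} d _ _ p≢q = ⊥-elim (p≢q refl)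
∣p*d-q*d∣≡d {0} {1} d _ _ _   = +-identityʳ d
∣p*d-q*d∣≡d {1} {0} d _ _ _   = trans (∣-∣-comm (d + 0) 0) (+-identityʳ d)
∣p*d-q*d∣≡d {1} {1} d _ _ p≢q = ⊥-elim (p≢q refl)
∣p*d-q*d∣≡d {suc (suc _)} d (s≤s (s≤s ())) _ _
∣p*d-q*d∣≡d {_} {suc (suc _)} d _ (s≤s (s≤s ())) _

m%d≡n%d⇒∣m-n∣≡d : ∀ d {m n} .{{_ : NonZero d}} → m < 2 * d → n < 2 * d →
                   m % d ≡ n % d → m ≢ n → ∣ m - n ∣ ≡ d
m%d≡n%d⇒∣m-n∣≡d d {m} {n} m<2d n<2d m%d≡n%d m≢n = begin
  ∣ m - n ∣                                 ≡⟨ cong₂ ∣_-_∣ (m≡m%n+[m/n]*n m d) n≡ ⟩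
  ∣ m % d + m / d * d - m % d + n / d * d ∣ ≡⟨ ∣m+n-m+o∣≡∣n-o∣ (m % d) _ _ ⟩
  ∣ m / d * d - n / d * d ∣                 ≡⟨ ∣p*d-q*d∣≡d d m/d<2 n/d<2 quotients≢ ⟩
  d                                         ∎
  where
  open ≡-Reasoning
  n≡ : n ≡ m % d + n / d * d
  n≡ = trans (m≡m%n+[m/n]*n n d) (cong (_+ n / d * d) (sym m%d≡n%d))
  m/d<2 : m / d < 2
  m/d<2 = m<n*o⇒m/o<n m<2d
  n/d<2 : n / d < 2
  n/d<2 = m<n*o⇒m/o<n n<2d
  quotients≢ : m / d ≢ n / d
  quotients≢ eq = m≢n (begin
    m                   ≡⟨ m≡m%n+[m/n]*n m d ⟩
    m % d + m / d * d   ≡⟨ cong (λ q → m % d + q * d) eq ⟩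
    m % d + n / d * d   ≡⟨ n≡ ⟨
    n                   ∎)

residueColouring-proper : ∀ {r s} .{{_ : NonZero r}} → s ≤ r →
  ColorableAfterRemoving (unstableGraph (suc (2 * r)) s) r ⁅ fromℕ (2 * r) ⁆
residueColouring-proper {r} {s} s≤r = colour , noMonochromaticEdge
  where
  colour : Fin (suc (2 * r)) → Fin r
  colour v = fromℕ< (m%n<n (toℕ v) r)

  below : ∀ {v} → v ∈ ∁ ⁅ fromℕ (2 * r) ⁆ → toℕ v < 2 * r
  below {v} v∈ = ≤∧≢⇒< (s≤s⁻¹ (toℕ<n v)) (v≢last ∘ toℕ-injective ∘ toLast)
    where
    v≢last : v ≢ fromℕ (2 * r)
    v≢last = x∉⁅y⁆⇒x≢y (x∈∁p⇒x∉p v∈)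
    toLast : toℕ v ≡ 2 * r → toℕ v ≡ toℕ (fromℕ (2 * r))
    toLast v≡2r = trans v≡2r (sym (toℕ-fromℕ (2 * r)))

  r-stable : StableDistance (suc (2 * r)) s r
  r-stable = s≤r , m+n≤o⇒m≤o∸n r r+s≤1+2r
    where
    open ≤-Reasoning
    r+s≤1+2r : r + s ≤ suc (2 * r)
    r+s≤1+2r = begin
      r + s        ≤⟨ +-monoʳ-≤ r s≤r ⟩
      r + r        ≡⟨ cong (r +_) (+-identityʳ r) ⟨
      2 * r        ≤⟨ n≤1+n (2 * r) ⟩
      suc (2 * r)  ∎

  noMonochromaticEdge : ∀ e → Edge (unstableGraph (suc (2 * r)) s) e →
    e ⊆ ∁ ⁅ fromℕ (2 * r) ⁆ → ¬ (∃ λ col → ∀ i → i ∈ e → colour i ≡ col)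
  noMonochromaticEdge _ (i , j , (i≢j , unstable) , refl) e⊆ (col , mono) =
    unstable (subst (StableDistance _ s) (sym distance≡r) r-stable)
    where
    open ≡-Reasoning
    sameResidue : toℕ i % r ≡ toℕ j % r
    sameResidue = begin
      toℕ i % r       ≡⟨ toℕ-fromℕ< _ ⟨
      toℕ (colour i)  ≡⟨ cong toℕ (trans (mono i ∈-pairˡ) (sym (mono j ∈-pairʳ))) ⟩
      toℕ (colour j)  ≡⟨ toℕ-fromℕ< _ ⟩
      toℕ j % r       ∎
    distance≡r : ∣ toℕ i - toℕ j ∣ ≡ r
    distance≡r = m%d≡n%d⇒∣m-n∣≡d r (below (e⊆ ∈-pairˡ)) (below (e⊆ ∈-pairʳ)) sameResidue
                   (i≢j ∘ toℕ-injective)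

1+2r<3s : ∀ {s r} → 3 ≤ s → r ≤ s + ⌈ s ∸ 3 / 2 ⌉ → suc (2 * r) < 3 * s
1+2r<3s {suc (suc (suc t))} {r} _ r≤ = begin
  2 + 2 * r                 ≤⟨ +-monoʳ-≤ 2 (*-monoʳ-≤ 2 r≤) ⟩
  2 + 2 * (3 + t + q)       ≡⟨ expand t q ⟩
  8 + 2 * t + q * 2         ≤⟨ +-monoʳ-≤ (8 + 2 * t) (m/n*n≤m (t + 1) 2) ⟩
  8 + 2 * t + (t + 1)       ≡⟨ collect t ⟩
  3 * (3 + t)               ∎
  where
  open ≤-Reasoning
  q : ℕ
  q = (t + 1) / 2
  expand : ∀ t q → 2 + 2 * (3 + t + q) ≡ 8 + 2 * t + q * 2
  expand = solve-∀
  collect : ∀ t → 8 + 2 * t + (t + 1) ≡ 3 * (3 + t)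
  collect = solve-∀
1+2r<3s {1} (s≤s ()) _
1+2r<3s {2} (s≤s (s≤s ())) _

⌈1/r∸1⌉≡1 : ∀ {r} → 1 < r → ⌈ 1 / r ∸ 1 ⌉ ≡ 1
⌈1/r∸1⌉≡1 {suc (suc d)} _ = n/n≡1 (suc d)
⌈1/r∸1⌉≡1 {1} (s≤s ())

theorem1p10 : (s r : ℕ) → 4 ≤ s → suc s ≤ r → r ≤ s + ⌈ s ∸ 3 / 2 ⌉ →
    ∃ λ (n : ℕ) → (suc (2 * r) ≤ n) × (Σ (Hypergraph n) λ G → IsGraph G ×
    (∃ λ (χ : ℕ) → IsChromaticNumber (KG r (stablePart s G)) χ × χ ≡ 0) ×
    (∃ λ (d : ℕ) → IsColorabilityDefect G r d × ⌈ d / r ∸ 1 ⌉ ≡ 1))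
theorem1p10 s r 4≤s s<r r≤ =
  n , ≤-refl , G , unstableGraph-isGraph n s ,
  (0 , KG-edgeless-χ≡0 r (stablePart s G) (stablePart-unstableGraph-edgeless s) , refl) ,
  (1 , ((⁅ fromℕ (2 * r) ⁆ , ∣⁅x⁆∣≡1 (fromℕ (2 * r)) , residueColouring-proper (<⇒≤ s<r)) ,
        unstableGraph-needsRemoval r*2<n (1+2r<3s (<⇒≤ 4≤s) r≤)) ,
   ⌈1/r∸1⌉≡1 1<r)
  where
  n : ℕ
  n = suc (2 * r)
  G : Hypergraph n
  G = unstableGraph n s
  1<r : 1 < r
  1<r = ≤-trans (≤-trans (s≤s (s≤s z≤n)) 4≤s) (<⇒≤ s<r)
  instance
    r-nonZero : NonZero r
    r-nonZero = >-nonZero (<-trans z<s 1<r)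
  r*2<n : r * 2 < n
  r*2<n = s≤s (≤-reflexive (*-comm r 2))
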